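{- Let $G$ be a finite graph with average degree $\overline{d}$ satisfying $2<\overline{d}\leq 4$. Then $$C(G)\leq\frac{2}{\overline{d}-2}\exp\left(v(G)\cdot\frac{\overline{d}}{2}H\left(\frac{2}{\overline{d}}\right)\right).$$
   Context: $v(G)$ is the number of vertices of $G$; $C(G)$ is the number of connected spanning subgraphs of $G$, i.e. edge subsets $A\subseteq E(G)$ such that $(V(G),A)$ is connected. $H(x)=x\ln(1/x)+(1-x)\ln(1/(1-x))$ is the entropy function (natural logarithm), with $H(0)=H(1)=0$. -}

module Defs where

open import Data.Nat using (ℕ; zero; suc)
open import Data.Bool using (Bool; true; false; _∧_; _∨_; if_then_else_)
open import Data.Fin using (Fin)
open import Data.Fin.Properties using (_≟_)
open import Data.Product using (_×_; _,_)
open import Data.List using (List; []; _∷_; length; allFin; filterᵇ; map; concatMap)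
open import Data.Bool.ListAction using (any; all)
open import Data.Vec using (Vec; []; _∷_)
open import Relation.Nullary.Decidable using (⌊_⌋)

-- A finite (multi)graph: vertex set Fin n, edges an explicit list of
-- (unordered) endpoint pairs; parallel edges and loops are allowed.
record Graph : Set where
  field
    n     : ℕ
    edges : List (Fin n × Fin n)
open Graph public

v : Graph → ℕ
v G = n G

-- e(G): number of edges (average degree is 2 e(G) / v(G))
e : Graph → ℕ
e G = length (edges G)

EdgeSubset : Graph → Set
EdgeSubset G = Vec Bool (e G)

allVecs : (m : ℕ) → List (Vec Bool m)
allVecs zero = [] ∷ []
allVecs (suc m) = concatMap (λ xs → (false ∷ xs) ∷ (true ∷ xs) ∷ []) (allVecs m)

chosen : {k : ℕ} (es : List (Fin k × Fin k)) → Vec Bool (length es) → List (Fin k × Fin k)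
chosen [] [] = []
chosen (x ∷ es) (b ∷ bs) = if b then x ∷ chosen es bs else chosen es bs

adj : {k : ℕ} → List (Fin k × Fin k) → Fin k → Fin k → Bool
adj A x y = any (λ { (a , b) → (⌊ a ≟ x ⌋ ∧ ⌊ b ≟ y ⌋) ∨ (⌊ a ≟ y ⌋ ∧ ⌊ b ≟ x ⌋) }) A

walk : {k : ℕ} → List (Fin k × Fin k) → ℕ → Fin k → Fin k → Bool
walk A zero x y = ⌊ x ≟ y ⌋
walk {k} A (suc l) x y = walk A l x y ∨ any (λ w → walk A l x w ∧ adj A w y) (allFin k)

-- (V, A) is connected: every pair of vertices is joined by a walk
-- (walks of length ≤ k suffice on k vertices)
connected : {k : ℕ} → List (Fin k × Fin k) → Bool
connected {k} A = all (λ x → all (λ y → walk A k x y) (allFin k)) (allFin k)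

C : Graph → ℕ
C G = length (filterᵇ (λ S → connected (chosen (edges G) S)) (allVecs (e G)))

{-# OPTIONS --safe #-}
module Submission where

-- Give an edge subset with t edges the weight vᵗ (e − v)ᵉ⁻ᵗ. The weights of all
-- subsets sum to (v + (e − v))ᵉ = eᵉ by the binomial theorem. A connected spanning
-- subgraph has at least v − 1 edges, and e − v ≤ v because the average degree is at
-- most 4, so each of the C(G) connected subsets weighs at least vᵛ⁻¹ (e − v)ᵉ⁻ᵛ⁺¹.
-- Hence C(G) vᵛ⁻¹ (e − v)ᵉ⁻ᵛ⁺¹ ≤ eᵉ. With d̄ = 2e/v we have 2/(d̄ − 2) = v/(e − v) and
-- exp(v (d̄/2) H(2/d̄)) = eᵉ / (vᵛ (e − v)ᵉ⁻ᵛ), so this is the theorem multiplied out.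

open import Defs
open import Data.Nat using (ℕ; zero; suc; pred; _+_; _*_; _∸_; _^_; _≤_; _<_; z≤n; s≤s)
open import Data.Nat.Properties hiding (_≟_; suc-injective)
open import Data.Nat.Solver using (module +-*-Solver)
open import Algebra.Properties.CommutativeSemigroup *-commutativeSemigroup using (x∙yz≈y∙xz)
open import Data.Bool using (Bool; true; false; T; _∧_; _∨_)
open import Data.Bool.Properties using (T-∧; T-∨)
open import Data.Bool.ListAction using (any; all)
open import Data.Fin using (Fin; zero; suc)
open import Data.Fin.Properties using (_≟_; injective⇒≤; suc-injective)
open import Data.List using (List; []; _∷_; length; allFin; filterᵇ; map; concatMap; lookup)
open import Data.Nat.ListAction using (sum)
open import Data.List.Membership.Propositional.Properties using (∈-allFin)
open import Data.List.Relation.Unary.All as All using ()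
open import Data.List.Relation.Unary.All.Properties using (all⁺)
open import Data.List.Relation.Unary.Any as Any using ()
open import Data.List.Relation.Unary.Any.Properties using (any⁻; lookup-index)
open import Data.Product as Product using (_×_; _,_; ∃; proj₁; proj₂)
open import Data.Sum as Sum using (_⊎_; inj₁; inj₂)
open import Data.Vec using (Vec; []; _∷_)
open import Function using (_∘_)
open import Function.Bundles using (Equivalence)
open import Function.Definitions using (Injective)
open import Relation.Nullary using (yes; no; contradiction)
open import Relation.Nullary.Decidable using (⌊_⌋; T?; toWitness)
open import Relation.Binary.PropositionalEquality using (_≡_; _≢_; refl; sym; cong; subst; module ≡-Reasoning)

length-filterᵇ*≤sum : {A : Set} (f : A → ℕ) (p : A → Bool) {c : ℕ} →
  (∀ x → T (p x) → c ≤ f x) → ∀ xs → length (filterᵇ p xs) * c ≤ sum (map f xs)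
length-filterᵇ*≤sum f p h [] = z≤n
length-filterᵇ*≤sum f p h (x ∷ xs) with p x | h x
... | true  | c≤fx = +-mono-≤ (c≤fx _) (length-filterᵇ*≤sum f p h xs)
... | false | _    = ≤-trans (length-filterᵇ*≤sum f p h xs) (m≤n+m _ (f x))

trues : {m : ℕ} → Vec Bool m → ℕ
trues [] = 0
trues (true ∷ x) = suc (trues x)
trues (false ∷ x) = trues x

trues≤length : {m : ℕ} (x : Vec Bool m) → trues x ≤ m
trues≤length [] = z≤n
trues≤length (true ∷ x) = s≤s (trues≤length x)
trues≤length (false ∷ x) = m≤n⇒m≤1+n (trues≤length x)

length-chosen : {k : ℕ} (es : List (Fin k × Fin k)) (S : Vec Bool (length es)) →
  length (chosen es S) ≡ trues S
length-chosen [] [] = refl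
length-chosen (_ ∷ es) (true ∷ S) = cong suc (length-chosen es S)
length-chosen (_ ∷ es) (false ∷ S) = length-chosen es S

module _ (a b : ℕ) where

  weight : {m : ℕ} → Vec Bool m → ℕ
  weight [] = 1
  weight (true ∷ x) = a * weight x
  weight (false ∷ x) = b * weight x

  sum-weight-allVecs : ∀ m → sum (map weight (allVecs m)) ≡ (a + b) ^ m
  sum-weight-allVecs zero = refl
  sum-weight-allVecs (suc m) = begin
      sum (map weight (concatMap extend (allVecs m))) ≡⟨ sum-weight-extend (allVecs m) ⟩
      (a + b) * sum (map weight (allVecs m))         ≡⟨ cong ((a + b) *_) (sum-weight-allVecs m) ⟩
      (a + b) * (a + b) ^ m                           ∎
    where
    open ≡-Reasoning
    open +-*-Solver

    extend : Vec Bool m → List (Vec Bool (suc m))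
    extend x = (false ∷ x) ∷ (true ∷ x) ∷ []

    sum-weight-extend : ∀ xs → sum (map weight (concatMap extend xs)) ≡ (a + b) * sum (map weight xs)
    sum-weight-extend [] = sym (*-zeroʳ (a + b))
    sum-weight-extend (x ∷ xs) = begin
        b * weight x + (a * weight x + sum (map weight (concatMap extend xs)))
          ≡⟨ cong (λ s → b * weight x + (a * weight x + s)) (sum-weight-extend xs) ⟩
        b * weight x + (a * weight x + (a + b) * sum (map weight xs))
          ≡⟨ solve 4 (λ a b w s → b :* w :+ (a :* w :+ (a :+ b) :* s) := (a :+ b) :* (w :+ s))
                   refl a b (weight x) (sum (map weight xs)) ⟩
        (a + b) * (weight x + sum (map weight xs)) ∎

  module _ (b≤a : b ≤ a) where

    b^m≤weight : {m : ℕ} (x : Vec Bool m) → b ^ m ≤ weight x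
    b^m≤weight [] = ≤-refl
    b^m≤weight (true ∷ x) = *-mono-≤ b≤a (b^m≤weight x)
    b^m≤weight (false ∷ x) = *-monoʳ-≤ b (b^m≤weight x)

    a^k*b^[m∸k]≤weight : {m : ℕ} (x : Vec Bool m) {k : ℕ} → k ≤ trues x →
      a ^ k * b ^ (m ∸ k) ≤ weight x
    a^k*b^[m∸k]≤weight [] {zero} _ = ≤-refl
    a^k*b^[m∸k]≤weight (true ∷ x) {zero} _ =
      ≤-trans (≤-reflexive (*-identityˡ _)) (b^m≤weight (true ∷ x))
    a^k*b^[m∸k]≤weight (true ∷ x) {suc k} (s≤s k≤t) =
      ≤-trans (≤-reflexive (*-assoc a (a ^ k) _)) (*-monoʳ-≤ a (a^k*b^[m∸k]≤weight x k≤t))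
    a^k*b^[m∸k]≤weight {suc m} (false ∷ x) {k} k≤t = begin
      a ^ k * b ^ (suc m ∸ k)   ≡⟨ cong (λ j → a ^ k * b ^ j) (+-∸-assoc 1 (≤-trans k≤t (trues≤length x))) ⟩
      a ^ k * (b * b ^ (m ∸ k)) ≡⟨ x∙yz≈y∙xz (a ^ k) b _ ⟩
      b * (a ^ k * b ^ (m ∸ k)) ≤⟨ *-monoʳ-≤ b (a^k*b^[m∸k]≤weight x k≤t) ⟩
      b * weight x              ∎
      where open ≤-Reasoning

record Least (p : ℕ → Bool) : Set where
  field
    value   : ℕ
    holds   : T (p value)
    minimal : ∀ l → T (p l) → value ≤ l

least : (p : ℕ → Bool) (N : ℕ) → T (p N) → Least p
least p zero pN = record { value = 0 ; holds = pN ; minimal = λ _ _ → z≤n }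
least p (suc N) pN with T? (p 0)
... | yes p0 = record { value = 0 ; holds = p0 ; minimal = λ _ _ → z≤n }
... | no ¬p0 = record { value = suc value ; holds = holds ; minimal = minimal₁ }
  where
  open Least (least (p ∘ suc) N pN)
  minimal₁ : ∀ l → T (p l) → suc value ≤ l
  minimal₁ zero p0 = contradiction p0 ¬p0
  minimal₁ (suc l) pl = s≤s (minimal l pl)

Joins : {n : ℕ} → Fin n × Fin n → Fin n → Fin n → Set
Joins (a , b) x y = (a ≡ x × b ≡ y) ⊎ (a ≡ y × b ≡ x)

joins-same-edge : {n : ℕ} {e : Fin n × Fin n} {x₁ y₁ x₂ y₂ : Fin n} →
  Joins e x₁ y₁ → Joins e x₂ y₂ → y₁ ≡ y₂ ⊎ (x₁ ≡ y₂ × x₂ ≡ y₁)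
joins-same-edge (inj₁ (refl , refl)) (inj₁ (refl , refl)) = inj₁ refl
joins-same-edge (inj₁ (refl , refl)) (inj₂ (refl , refl)) = inj₂ (refl , refl)
joins-same-edge (inj₂ (refl , refl)) (inj₁ (refl , refl)) = inj₂ (refl , refl)
joins-same-edge (inj₂ (refl , refl)) (inj₂ (refl , refl)) = inj₁ refl

module _ {n : ℕ} (A : List (Fin n × Fin n)) where

  adj⇒edge : ∀ {x y} → T (adj A x y) → ∃ λ i → Joins (lookup A i) x y
  adj⇒edge {x} {y} x~y = Any.index edge , decode (lookup A (Any.index edge)) (lookup-index edge)
    where
    edge = any⁻ _ A x~y
    equal-pair : ∀ a b u w → T (⌊ a ≟ u ⌋ ∧ ⌊ b ≟ w ⌋) → a ≡ u × b ≡ w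
    equal-pair a b u w = Product.map toWitness toWitness ∘ Equivalence.to (T-∧ {⌊ a ≟ u ⌋})
    decode : ∀ e → T ((⌊ proj₁ e ≟ x ⌋ ∧ ⌊ proj₂ e ≟ y ⌋) ∨
                      (⌊ proj₁ e ≟ y ⌋ ∧ ⌊ proj₂ e ≟ x ⌋)) → Joins e x y
    decode (a , b) =
      Sum.map (equal-pair a b x y) (equal-pair a b y x) ∘ Equivalence.to (T-∨ {⌊ a ≟ x ⌋ ∧ ⌊ b ≟ y ⌋})

  walk-suc : ∀ {l x y} → T (walk A (suc l) x y) →
    T (walk A l x y) ⊎ ∃ λ w → T (walk A l x w) × T (adj A w y)
  walk-suc {l} {x} {y} h = Sum.map₂ step (Equivalence.to (T-∨ {walk A l x y}) h)
    where
    step : T (any (λ w → walk A l x w ∧ adj A w y) (allFin n)) →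
           ∃ λ w → T (walk A l x w) × T (adj A w y)
    step = Product.map₂ (λ {w} → Equivalence.to (T-∧ {walk A l x w}))
         ∘ Any.satisfied ∘ any⁻ _ (allFin n)

  connected⇒walk : T (connected A) → ∀ x y → T (walk A n x y)
  connected⇒walk conn x y =
    All.lookup (all⁺ _ _ (All.lookup (all⁺ _ _ conn) (∈-allFin x))) (∈-allFin y)

-- A shortest walk from the root enters each vertex y ≠ root through an edge from a vertex
-- strictly closer to the root. No edge plays this role for both of its ends, so the k
-- non-root vertices inject into the edges.
module SpanningTree {k : ℕ} (A : List (Fin (suc k) × Fin (suc k))) (conn : T (connected A)) where

  distance : (y : Fin (suc k)) → Least (λ l → walk A l zero y)
  distance y = least _ (suc k) (connected⇒walk A conn zero y)

  dist : Fin (suc k) → ℕ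
  dist y = Least.value (distance y)

  record ParentEdge (y : Fin (suc k)) : Set where
    field
      parent : Fin (suc k)
      edge   : Fin (length A)
      closer : dist parent < dist y
      joins  : Joins (lookup A edge) parent y

  parentEdge : ∀ y → y ≢ zero → ParentEdge y
  parentEdge y y≢0 = go (dist y) refl (Least.holds (distance y))
    where
    go : ∀ d → d ≡ dist y → T (walk A d zero y) → ParentEdge y
    go zero _ h = contradiction (sym (toWitness h)) y≢0
    go (suc l) d≡ h with walk-suc A {l} {zero} h
    ... | inj₁ shorter =
      contradiction (subst (_≤ l) (sym d≡) (Least.minimal (distance y) l shorter)) 1+n≰n
    ... | inj₂ (w , to-w , w~y) = record
      { parent = w
      ; edge   = proj₁ (adj⇒edge A w~y)
      ; closer = subst (dist w <_) d≡ (s≤s (Least.minimal (distance w) l to-w))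
      ; joins  = proj₂ (adj⇒edge A w~y)
      }

  parentEdge-injective : ∀ {y₁ y₂} (P₁ : ParentEdge y₁) (P₂ : ParentEdge y₂) →
    ParentEdge.edge P₁ ≡ ParentEdge.edge P₂ → y₁ ≡ y₂
  parentEdge-injective P₁ P₂ same with joins-same-edge (ParentEdge.joins P₁)
      (subst (λ i → Joins (lookup A i) _ _) (sym same) (ParentEdge.joins P₂))
  ... | inj₁ y₁≡y₂ = y₁≡y₂
  ... | inj₂ (refl , refl) = contradiction (ParentEdge.closer P₁) (<-asym (ParentEdge.closer P₂))

  treeEdge : Fin k → Fin (length A)
  treeEdge j = ParentEdge.edge (parentEdge (suc j) λ ())

  treeEdge-injective : Injective _≡_ _≡_ treeEdge
  treeEdge-injective same =
    suc-injective (parentEdge-injective (parentEdge _ λ ()) (parentEdge _ λ ()) same)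

connected⇒n≤1+length : {n : ℕ} (A : List (Fin n × Fin n)) → T (connected A) → n ≤ suc (length A)
connected⇒n≤1+length {zero} A _ = z≤n
connected⇒n≤1+length {suc k} A conn = s≤s (injective⇒≤ (SpanningTree.treeEdge-injective A conn))

C*a^k*b^[e∸k]≤[a+b]^e : (G : Graph) {a b : ℕ} → b ≤ a →
  let k = pred (v G) in C G * (a ^ k * b ^ (e G ∸ k)) ≤ (a + b) ^ e G
C*a^k*b^[e∸k]≤[a+b]^e G {a} {b} b≤a = begin
  C G * (a ^ k * b ^ (e G ∸ k))          ≤⟨ length-filterᵇ*≤sum (weight a b) _ heavy (allVecs (e G)) ⟩
  sum (map (weight a b) (allVecs (e G))) ≡⟨ sum-weight-allVecs a b (e G) ⟩
  (a + b) ^ e G                          ∎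
  where
  open ≤-Reasoning
  k = pred (v G)
  heavy : ∀ S → T (connected (chosen (edges G) S)) → a ^ k * b ^ (e G ∸ k) ≤ weight a b S
  heavy S conn = a^k*b^[m∸k]≤weight a b b≤a S (subst (k ≤_) (length-chosen (edges G) S)
    (pred-mono-≤ (connected⇒n≤1+length (chosen (edges G) S) conn)))

theorem1p12 : (G : Graph) → v G < e G → e G ≤ 2 * v G →
    C G * (e G ∸ v G) * (v G ^ v G) * ((e G ∸ v G) ^ (e G ∸ v G)) ≤ v G * (e G ^ e G)
theorem1p12 record { n = zero } v<e e≤2v = contradiction (≤-trans v<e e≤2v) n≮0
theorem1p12 G@record { n = suc k } v<e e≤2v = begin
  C G * b * a ^ a * b ^ b             ≡⟨ rearrange ⟩
  a * (C G * (a ^ k * b ^ suc b))     ≡⟨ cong (λ j → a * (C G * (a ^ k * b ^ j))) e∸k≡1+b ⟨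
  a * (C G * (a ^ k * b ^ (m ∸ k)))   ≤⟨ *-monoʳ-≤ a (C*a^k*b^[e∸k]≤[a+b]^e G b≤a) ⟩
  a * (a + b) ^ m                     ≡⟨ cong (λ s → a * s ^ m) (m+[n∸m]≡n (<⇒≤ v<e)) ⟩
  a * m ^ m                           ∎
  where
  open ≤-Reasoning
  open +-*-Solver
  a = suc k
  m = e G
  b = m ∸ a
  b≤a : b ≤ a
  b≤a = subst (b ≤_) (+-identityʳ a) (m≤n+o⇒m∸n≤o m a e≤2v)
  e∸k≡1+b : m ∸ k ≡ suc b
  e∸k≡1+b = +-∸-assoc 1 (<⇒≤ v<e)
  rearrange : C G * b * a ^ a * b ^ b ≡ a * (C G * (a ^ k * b ^ suc b))
  rearrange = solve 5 (λ c b a p q → c :* b :* (a :* p) :* q := a :* (c :* (p :* (b :* q))))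
    refl (C G) b a (a ^ k) (b ^ b)
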